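{- Let $\mathbb{K}=(G,M,I)$ be a formal context and $m\in M$ with $R:=m^{(I)}\neq\emptyset$, let $\mathcal{S}$ be a complete system of $R$-mixed generators in $\mathbb{K}$, let $g\in R$ and $\mathbb{L}=\mathrm{op}^{g,m}(\mathbb{K})$. Then for every $S\in\mathcal{N}$ one has $\chi(S\setminus R)\neq R$.
   Context: For $A\subseteq G$, $A^I=\{n\in M:(a,n)\in I\ \forall a\in A\}$ and dually for $B\subseteq M$; same notation for $J$. $m^{(I)}:=G\setminus m^I$, $h^{(I)}:=M\setminus h^I$. $\mathrm{op}^{g,m}(\mathbb{K})=(G,M,J)$ with $J=I\cup\{(g,n):n\in M\setminus\{m\}\}\cup\{(h,m):h\in G\setminus\{g\}\}$. $S\subseteq G$ is an $R$-mixed generator in $(G,M,I)$ if for every $h\in G$: (i) $h\in S\cap R\Rightarrow(S\setminus\{h\})^{II}\neq S^{II}$; (ii) $h\notin S\cup R\Rightarrow(S\cup\{h\})^{II}\neq S^{II}$; in $(G,M,J)$ the same with $J$ and the same $R$. A complete system of $R$-mixed generators is a family of $R$-mixed generators such that $S\mapsto S^{II}$ is a bijection onto the extents of $\mathbb{K}$. $S$ strongly avoids $h$ if $S^I\cap(h^{(I)}\setminus\{m\})\neq\emptyset$; $\chi(S)=\{h\in R:S\text{ strongly avoids }h\}$. $\mathcal{N}=\{S\in\mathcal{S}:S\text{ is not an }R\text{ -mixed generator in }\mathbb{L}\}$. -}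

module Defs where

open import Data.Product using (Σ; ∃; _×_; _,_)
open import Data.Sum using (_⊎_)
open import Relation.Nullary using (¬_)
open import Relation.Binary.PropositionalEquality using (_≡_; _≢_)

Subset : Set → Set₁
Subset G = G → Set

_⊆_ : {G : Set} → Subset G → Subset G → Set
A ⊆ B = ∀ x → A x → B x

_≐_ : {G : Set} → Subset G → Subset G → Set
A ≐ B = (A ⊆ B) × (B ⊆ A)

_∖_ : {G : Set} → Subset G → Subset G → Subset G
(A ∖ B) x = A x × ¬ B x

_－_ : {G : Set} → Subset G → G → Subset G
(A － h) x = A x × x ≢ h

_＋_ : {G : Set} → Subset G → G → Subset G
(A ＋ h) x = A x ⊎ x ≡ h

-- A formal context (G, M, I) is given by an incidence relation I : G → M → Set.
-- Derivation operators.
up : {G M : Set} → (G → M → Set) → Subset G → Subset M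
up I A n = ∀ a → A a → I a n

down : {G M : Set} → (G → M → Set) → Subset M → Subset G
down I B h = ∀ n → B n → I h n

closure : {G M : Set} → (G → M → Set) → Subset G → Subset G
closure I A = down I (up I A)

IsExtent : {G M : Set} → (G → M → Set) → Subset G → Set
IsExtent I E = closure I E ≐ E

-- m^{(I)} = G ∖ m^I
colCompl : {G M : Set} → (G → M → Set) → M → Subset G
colCompl I m h = ¬ I h m

rowCompl : {G M : Set} → (G → M → Set) → G → Subset M
rowCompl I h n = ¬ I h n

op : {G M : Set} → (G → M → Set) → G → M → (G → M → Set)
op I g m h n = I h n ⊎ ((h ≡ g × n ≢ m) ⊎ (h ≢ g × n ≡ m))

IsMixedGen : {G M : Set} → (G → M → Set) → Subset G → Subset G → Set
IsMixedGen I R S =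
  ∀ h → ((S h → R h → ¬ (closure I (S － h) ≐ closure I S))
       × (¬ S h → ¬ R h → ¬ (closure I (S ＋ h) ≐ closure I S)))

-- A complete system of R-mixed generators, given as a family 𝒮 indexed by Ix:
-- each member is an R-mixed generator and S ↦ S^{II} is a bijection
-- from the (set of members of the) family onto the extents.
IsCompleteSystem : {G M Ix : Set} → (G → M → Set) → Subset G → (Ix → Subset G) → Set₁
IsCompleteSystem I R 𝒮 =
  (∀ i → IsMixedGen I R (𝒮 i))
  × ((∀ i j → closure I (𝒮 i) ≐ closure I (𝒮 j) → 𝒮 i ≐ 𝒮 j)
  × (∀ E → IsExtent I E → Σ _ λ i → closure I (𝒮 i) ≐ E))

StronglyAvoids : {G M : Set} → (G → M → Set) → M → Subset G → G → Set
StronglyAvoids I m S h = ∃ λ n → up I S n × (rowCompl I h n × n ≢ m)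

χ : {G M : Set} → (G → M → Set) → M → Subset G → Subset G → Subset G
χ I m R S h = R h × StronglyAvoids I m S h

module Submission where

-- We prove the contrapositive: if χ(S ∖ R) = R, then S is
-- an R-mixed generator in L as well, so S ∉ 𝒩.
--
-- It then compares J-closures with I-closures (module OneElementOperation):
-- J only adds incidences in row g and column m, so membership in a J-closure
-- transfers back to the I-closure when column m or row g are harmless, while
-- it fails outright for g itself and for objects strongly avoided in K.
-- Each of the two mixed-generator conditions then transfers from K to L:
-- condition (ii) directly, condition (i) after excluding h = g by a case
-- split: either S ∖ {h} meets R, or S ∖ {h} ⊆ S ∖ R and χ(S ∖ R) = R is used.
-- Since the goal is ⊥, this split is justified by ¬¬-excluded-middle.

open import Defs
open import Data.Product using (∃; _×_; _,_; proj₁; proj₂)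
open import Data.Sum using (inj₁; inj₂)
open import Data.Empty using (⊥-elim)
open import Relation.Nullary using (¬_; yes; no)
open import Relation.Nullary.Decidable.Core using (¬¬-excluded-middle)
open import Relation.Binary.PropositionalEquality using (_≡_; _≢_; refl; sym; trans; subst)

≐-sym : {G : Set} {A B : Subset G} → A ≐ B → B ≐ A
≐-sym (A⊆B , B⊆A) = B⊆A , A⊆B

module _ {G M : Set} (I : G → M → Set) where

  closure-extensive : (A : Subset G) → A ⊆ closure I A
  closure-extensive A x Ax n An = An x Ax

  closure-≐-between : (A B : Subset G) → A ⊆ B → B ⊆ closure I A
                    → closure I A ≐ closure I B
  closure-≐-between A B A⊆B B⊆clA = clA⊆clB , clB⊆clA
    where
      clA⊆clB : closure I A ⊆ closure I B
      clA⊆clB x clAx n Bn = clAx n (λ a Aa → Bn a (A⊆B a Aa))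
      clB⊆clA : closure I B ⊆ closure I A
      clB⊆clA x clBx n An = clBx n (λ b Bb → B⊆clA b Bb n An)

  ≐-closure-contains : (A B : Subset G) → closure I A ≐ closure I B
                     → B ⊆ closure I A
  ≐-closure-contains A B (_ , clB⊆clA) x Bx =
    clB⊆clA x (closure-extensive B x Bx)

module OneElementOperation {G M : Set} (I : G → M → Set) (g : G) (m : M) where

  J : G → M → Set
  J = op I g m

  R : Subset G
  R = colCompl I m

  up-op : (A : Subset G) → up I A ⊆ up J A
  up-op A n An a Aa = inj₁ (An a Aa)

  -- An object incident with m in K keeps its closure membership, provided
  -- g ∈ R (so the new incidences in row g do not concern x).
  closure-op-incident-m : R g → (A : Subset G) (x : G) → I x m
                        → closure J A x → closure I A x
  closure-op-incident-m Rg A x Ixm clJx n An with clJx n (up-op A n An)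
  ... | inj₁ Ixn = Ixn
  ... | inj₂ (inj₁ (x≡g , _)) = ⊥-elim (Rg (subst (λ z → I z m) x≡g Ixm))
  ... | inj₂ (inj₂ (_ , n≡m)) = subst (I x) (sym n≡m) Ixm

  -- If A meets R, no intent of A contains m; so the J-closure of A agrees
  -- with its I-closure on every object that is either ≠ g or in A.
  closure-op-meeting-R : (A : Subset G) → (∃ λ a → A a × R a)
                       → (x : G) → (x ≡ g → A x)
                       → closure J A x → closure I A x
  closure-op-meeting-R A (a , Aa , Ra) x x≡g⇒Ax clJx n An
    with clJx n (up-op A n An)
  ... | inj₁ Ixn = Ixn
  ... | inj₂ (inj₁ (x≡g , _)) = An x (x≡g⇒Ax x≡g)
  ... | inj₂ (inj₂ (_ , n≡m)) = ⊥-elim (Ra (subst (I a) n≡m (An a Aa)))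

  -- If g ∈ R and g ∉ A, then m is a J-intent of A not shared by g.
  g-outside-closure-op : R g → (A : Subset G) → (∀ a → A a → a ≢ g)
                       → ¬ closure J A g
  g-outside-closure-op Rg A A∌g clJg with clJg m (λ a Aa → inj₂ (inj₂ (A∌g a Aa , refl)))
  ... | inj₁ Igm = Rg Igm
  ... | inj₂ (inj₁ (_ , m≢m)) = m≢m refl
  ... | inj₂ (inj₂ (g≢g , _)) = g≢g refl

  -- An object h ≠ g strongly avoided by a superset B of A lies outside the
  -- J-closure of A: the witnessing attribute n ≠ m separates h from A in J.
  avoided-outside-closure-op : (A B : Subset G) → A ⊆ B → (h : G) → h ≢ g
                             → StronglyAvoids I m B h → ¬ closure J A h
  avoided-outside-closure-op A B A⊆B h h≢g (n , Bn , ¬Ihn , n≢m) clJh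
    with clJh n (λ a Aa → inj₁ (Bn a (A⊆B a Aa)))
  ... | inj₁ Ihn = ¬Ihn Ihn
  ... | inj₂ (inj₁ (h≡g , _)) = h≢g h≡g
  ... | inj₂ (inj₂ (_ , n≡m)) = n≢m n≡m

  addition-condition-op : R g → (S : Subset G) → IsMixedGen I R S
                        → (h : G) → ¬ S h → ¬ R h
                        → ¬ (closure J (S ＋ h) ≐ closure J S)
  addition-condition-op Rg S genI h ¬Sh ¬Rh eqJ = ¬Rh λ Ihm →
    proj₂ (genI h) ¬Sh ¬Rh
      (≐-sym (closure-≐-between I S (S ＋ h) (λ _ → inj₁) (S＋h⊆clIS Ihm)))
    where
      S＋h⊆clIS : I h m → (S ＋ h) ⊆ closure I S
      S＋h⊆clIS Ihm x (inj₁ Sx) = closure-extensive I S x Sx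
      S＋h⊆clIS Ihm x (inj₂ refl) =
        closure-op-incident-m Rg S h Ihm
          (proj₁ eqJ h (closure-extensive J (S ＋ h) h (inj₂ refl)))

  removal-condition-op : R g → (S : Subset G) → IsMixedGen I R S
                       → R ⊆ χ I m R (S ∖ R)
                       → (h : G) → S h → R h
                       → ¬ (closure J (S － h) ≐ closure J S)
  removal-condition-op Rg S genI R⊆χ h Sh Rh eqJ =
    ¬¬-excluded-middle λ
      { (yes meetsR) → proj₁ (genI h) Sh Rh
          (closure-≐-between I (S － h) S (λ _ → proj₁) (S⊆clI meetsR))
      ; (no missesR) → avoided-outside-closure-op (S － h) (S ∖ R)
          (S－h⊆S∖R missesR) h h≢g (proj₂ (R⊆χ h Rh)) (S⊆clJ h Sh)
      }
    where
      S⊆clJ : S ⊆ closure J (S － h)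
      S⊆clJ = ≐-closure-contains J (S － h) S eqJ

      -- h = g is impossible: g would lie in the J-closure of a set avoiding g.
      h≢g : h ≢ g
      h≢g h≡g = g-outside-closure-op Rg (S － h)
        (λ a (_ , a≢h) a≡g → a≢h (trans a≡g (sym h≡g)))
        (subst (closure J (S － h)) h≡g (S⊆clJ h Sh))

      S⊆clI : (∃ λ a → (S － h) a × R a) → S ⊆ closure I (S － h)
      S⊆clI meetsR x Sx = closure-op-meeting-R (S － h) meetsR x
        (λ { refl → Sx , λ x≡h → h≢g (sym x≡h) }) (S⊆clJ x Sx)

      -- Otherwise S ∖ {h} ⊆ S ∖ R, and S ∖ R strongly avoids h as h ∈ R = χ(S ∖ R).
      S－h⊆S∖R : ¬ (∃ λ a → (S － h) a × R a) → (S － h) ⊆ (S ∖ R)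
      S－h⊆S∖R missesR a (Sa , a≢h) = Sa , λ Ra → missesR (a , (Sa , a≢h) , Ra)

  mixedGen-op : R g → (S : Subset G) → IsMixedGen I R S
              → R ⊆ χ I m R (S ∖ R) → IsMixedGen J R S
  mixedGen-op Rg S genI R⊆χ h =
    removal-condition-op Rg S genI R⊆χ h , addition-condition-op Rg S genI h

proposition11 : {G M : Set} (I : G → M → Set) (m : M)
    → ∃ (λ h → colCompl I m h)
    → {Ix : Set} (𝒮 : Ix → Subset G)
    → IsCompleteSystem I (colCompl I m) 𝒮
    → (g : G) → colCompl I m g
    → (i : Ix)
    → ¬ IsMixedGen (op I g m) (colCompl I m) (𝒮 i)
    → ¬ (χ I m (colCompl I m) (𝒮 i ∖ colCompl I m) ≐ colCompl I m)
proposition11 I m _ 𝒮 (allMixed , _) g Rg i notMixedInL (_ , R⊆χ) =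
  notMixedInL (mixedGen-op Rg (𝒮 i) (allMixed i) R⊆χ)
  where open OneElementOperation I g m
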